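{- Let $S\subset\mathbb{F}_2^n$ with $\#S$ even, $\mathbf{0}\in S$ and $r=\dim\langle S\rangle=\#S-2$. Let $\mathbf{s}_1,\ldots,\mathbf{s}_r\in S$ be linearly independent, let $\mathbf{s}$ be the unique element of $S\setminus\{\mathbf{0},\mathbf{s}_1,\ldots,\mathbf{s}_r\}$, write $\mathbf{s}=\sum_{i=1}^r\alpha_i\mathbf{s}_i$ with $\alpha_i\in\mathbb{F}_2$, and let $k=\#\{i\mid\alpha_i=1\}$ (an integer). Define $e(x)=\frac{1+(-1)^x}{2}$ for integers $x$ and $$(\varphi_1(k),\varphi_2(k))=\begin{cases}(0,k)&\text{if } k<r/2,\\(1,k)&\text{if } k=r/2,\\ \left(k-\frac r2+e\!\left(k-\frac r2\right),\ \frac r2+e\!\left(\frac r2+1\right)\right)&\text{if } k>r/2.\end{cases}$$ Then $b(S)=0$ if $\varphi_1(k)>\varphi_2(k)$, and otherwise $$b(S)=\sum_{i=\varphi_1(k)}^{\varphi_2(k)}\binom{k}{i}\binom{r-k}{r/2+e(i)-i}.$$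
   Context: For $\mathbf{x},\mathbf{y}\in\mathbb{F}_2^n$ the pairing is $\mathbf{x}\cdot\mathbf{y}=\sum_{i=1}^n x_iy_i\in\mathbb{F}_2$, and $H_{\mathbf{y}}=\{\mathbf{x}\in\mathbb{F}_2^n\mid \mathbf{x}\cdot\mathbf{y}=0\}$. For a nonzero $\mathbf{y}$, a set $S$ is $\mathbf{y}$-balanced if $\#(S\cap H_{\mathbf{y}})=\#S/2$. $S$ is $\mathbf{y}$-constant if $S\subset H_{\mathbf{y}}$ or $S\cap H_{\mathbf{y}}=\emptyset$. The balancing set $B(S)$ is the set of nonzero $\mathbf{y}$ such that $S$ is $\mathbf{y}$-balanced; the constant set $C(S)$ is the set of $\mathbf{y}$ such that $S$ is $\mathbf{y}$-constant. The balancing number is $b(S)=\#B(S)/\#C(S)$. -}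

module Defs where

open import Data.Bool using (Bool; true; false; _∧_; _∨_; not; _xor_; if_then_else_)
open import Data.Nat using (ℕ; zero; suc; _+_; _*_; _∸_; _≡ᵇ_; _<ᵇ_; _/_; NonZero; _<_; _≤_)
open import Data.Nat.Combinatorics using (_C_)
open import Data.Integer using (ℤ; +_; -[1+_]) renaming (_+_ to _+ℤ_; _-_ to _-ℤ_)
open import Data.Rational using (ℚ) renaming (_/_ to _/ℚ_)
open import Data.List using (List; []; _∷_; _++_; map; length)
open import Data.Vec using (Vec; []; _∷_; replicate; zipWith; fromList; lookup)
open import Data.Fin using (Fin)
open import Data.Product using (Σ; _×_; _,_; ∃)
open import Relation.Binary.PropositionalEquality using (_≡_; refl; cong)

-- Vectors of F₂ⁿ are Vec Bool n  (false = 0, true = 1, xor = addition, ∧ = product)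
𝔽₂^ : ℕ → Set
𝔽₂^ n = Vec Bool n

𝟎 : ∀ {n} → 𝔽₂^ n
𝟎 {n} = replicate n false

_·_ : ∀ {n} → 𝔽₂^ n → 𝔽₂^ n → Bool
[] · [] = false
(x ∷ xs) · (y ∷ ys) = (x ∧ y) xor (xs · ys)

_⊕_ : ∀ {n} → 𝔽₂^ n → 𝔽₂^ n → 𝔽₂^ n
_⊕_ = zipWith _xor_

isZero : ∀ {n} → 𝔽₂^ n → Bool
isZero [] = true
isZero (x ∷ xs) = not x ∧ isZero xs

allVec : (n : ℕ) → List (𝔽₂^ n)
allVec zero = [] ∷ []
allVec (suc n) = map (false ∷_) (allVec n) ++ map (true ∷_) (allVec n)

count : ∀ {A : Set} → (A → Bool) → List A → ℕ
count p [] = 0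
count p (x ∷ xs) = if p x then suc (count p xs) else count p xs

allL : ∀ {A : Set} → (A → Bool) → List A → Bool
allL p [] = true
allL p (x ∷ xs) = p x ∧ allL p xs

inH : ∀ {n} → 𝔽₂^ n → 𝔽₂^ n → Bool
inH y x = not (x · y)

-- (finite sets S ⊂ F₂ⁿ are duplicate-free lists; #S = length S)
-- #(S ∩ H_y)
#S∩H : ∀ {n} → List (𝔽₂^ n) → 𝔽₂^ n → ℕ
#S∩H S y = count (inH y) S

balanced? : ∀ {n} → List (𝔽₂^ n) → 𝔽₂^ n → Bool
balanced? S y = (2 * #S∩H S y) ≡ᵇ length S

constant? : ∀ {n} → List (𝔽₂^ n) → 𝔽₂^ n → Bool
constant? S y = allL (inH y) S ∨ allL (λ x → not (inH y x)) S

#B : ∀ {n} → List (𝔽₂^ n) → ℕ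
#B {n} S = count (λ y → not (isZero y) ∧ balanced? S y) (allVec n)

#C : ∀ {n} → List (𝔽₂^ n) → ℕ
#C {n} S = count (constant? S) (allVec n)

-- #C(S) ≠ 0 since y = 0 is always constant
private
  ·𝟎 : ∀ {n} (x : 𝔽₂^ n) → x · 𝟎 ≡ false
  ·𝟎 [] = refl
  ·𝟎 (false ∷ xs) = ·𝟎 xs
  ·𝟎 (true ∷ xs) = ·𝟎 xs

  allH𝟎 : ∀ {n} (S : List (𝔽₂^ n)) → allL (inH 𝟎) S ≡ true
  allH𝟎 [] = refl
  allH𝟎 (x ∷ S) rewrite ·𝟎 x = allH𝟎 S

  const𝟎 : ∀ {n} (S : List (𝔽₂^ n)) → constant? S 𝟎 ≡ true
  const𝟎 S rewrite allH𝟎 S = refl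

  allVec-head : ∀ n → Σ (List (𝔽₂^ n)) (λ rest → allVec n ≡ 𝟎 ∷ rest)
  allVec-head zero = [] , refl
  allVec-head (suc n) with allVec n | allVec-head n
  ... | .(𝟎 ∷ rest) | rest , refl = _ , refl

  count-head : ∀ {A : Set} (p : A → Bool) x xs → p x ≡ true → NonZero (count p (x ∷ xs))
  count-head p x xs eq rewrite eq = _

#C-nonZero : ∀ {n} (S : List (𝔽₂^ n)) → NonZero (#C S)
#C-nonZero {n} S with allVec n | allVec-head n
... | .(𝟎 ∷ rest) | rest , refl = count-head (constant? S) 𝟎 rest (const𝟎 S)

b : ∀ {n} → List (𝔽₂^ n) → ℚ
b S = (+ #B S) /ℚ #C S
  where instance _ = #C-nonZero S

lincomb : ∀ {n m} → Vec Bool m → Vec (𝔽₂^ n) m → 𝔽₂^ n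
lincomb [] [] = 𝟎
lincomb (c ∷ cs) (v ∷ vs) = if c then v ⊕ lincomb cs vs else lincomb cs vs

LinIndep : ∀ {n m} → Vec (𝔽₂^ n) m → Set
LinIndep {n} {m} v = (c : Vec Bool m) → lincomb c v ≡ 𝟎 → c ≡ replicate m false

⟨_⟩ : ∀ {n} → List (𝔽₂^ n) → 𝔽₂^ n → Set
⟨ S ⟩ x = Σ (Vec Bool (length S)) (λ c → lincomb c (fromList S) ≡ x)

HasDim : ∀ {n} → (𝔽₂^ n → Set) → ℕ → Set
HasDim {n} V r = Σ (Vec (𝔽₂^ n) r) λ v →
  LinIndep v × ((i : Fin r) → V (lookup v i)) × ((x : 𝔽₂^ n) → V x → Σ (Vec Bool r) (λ c → lincomb c v ≡ x))

weight : ∀ {m} → Vec Bool m → ℕ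
weight [] = 0
weight (x ∷ xs) = if x then suc (weight xs) else weight xs

-- e(x) = (1 + (-1)^x)/2 : 1 if x even, 0 if odd  (for x ∈ ℤ)
even? : ℕ → Bool
even? zero = true
even? (suc zero) = false
even? (suc (suc n)) = even? n

eℤ : ℤ → ℕ
eℤ (+ n) = if even? n then 1 else 0
eℤ -[1+ n ] = if even? (suc n) then 1 else 0

e : ℕ → ℕ
e n = eℤ (+ n)

-- (φ₁(k), φ₂(k)) for given r (r even, r/2 = r / 2)
φ : ℕ → ℕ → ℕ × ℕ
φ r k = if k <ᵇ (r / 2) then (0 , k)
        else if k ≡ᵇ (r / 2) then (1 , k)
        else (k ∸ (r / 2) + e (k ∸ (r / 2)) , (r / 2) + e ((r / 2) + 1))

-- binomial coefficient with integer lower index (0 if negative)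
binomℤ : ℕ → ℤ → ℕ
binomℤ m (+ j) = m C j
binomℤ m -[1+ j ] = 0

-- Σ_{i=a}^{b} f i  (empty if a > b)
sumRange : ℕ → ℕ → (ℕ → ℕ) → ℕ
sumRange a b f = go (suc b ∸ a)
  where
  go : ℕ → ℕ
  go zero = 0
  go (suc t) = f (a + t) + go t

term : ℕ → ℕ → ℕ → ℕ
term r k i = (k C i) * binomℤ (r ∸ k) ((+ (r / 2) +ℤ + e i) -ℤ + i)

-- The r + 2 distinct vectors 0, s, s₁, …, s_r exhaust S, so whether S is y-constant or y-balanced
-- depends only on γ = (s₁ · y, …, s_r · y) ∈ 𝔽₂ʳ: S is y-constant iff γ = 0, and y-balanced iff
-- weight γ = r/2 + e(a), where a is the number of ones of γ on the support of α (s · y = α · γ has the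
-- parity of a). Since the sᵢ are independent, orthogonality of the characters of 𝔽₂ʳ shows that y ↦ γ
-- hits every point of 𝔽₂ʳ exactly 2ⁿ⁻ʳ times, so b(S) is the number of balanced γ. Splitting γ along the
-- support of α counts them as Σₐ C(k, a) C(r − k, r/2 + e(a) − a), and the summands with a outside
-- [φ₁(k), φ₂(k)] vanish.

module Submission where

open import Defs
open import Data.Bool using (Bool; true; false; _∧_; not; _xor_; if_then_else_; T)
open import Data.Bool.Properties as BP using ()
open import Data.Nat using (ℕ; zero; suc; _+_; _*_; _∸_; _^_; _≡ᵇ_; _<ᵇ_; _≤_; _<_; _≤?_; _<?_; z≤n; s≤s; NonZero)
import Data.Nat.Properties as NP
import Data.Nat as ℕ
open import Data.Nat.Divisibility using (_∣_; ∣m+n∣m⇒∣n; ∣-refl)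
open import Data.Nat.DivMod using (m/n*n≡m)
open import Data.Rational using (0ℚ; _/_)
import Data.Rational.Properties as QP
import Data.Rational.Unnormalised.Base as QU
open import Data.Integer using (ℤ; +_; 0ℤ; 1ℤ; -1ℤ) renaming (_+_ to _+ℤ_; _*_ to _*ℤ_; -_ to -ℤ_; _-_ to _-ℤ_)
import Data.Integer.Properties as ZP
open import Algebra.Bundles using (CommutativeRing)
open import Algebra.Properties.CommutativeSemigroup ZP.+-commutativeSemigroup using () renaming (interchange to +ℤ-interchange)
open import Algebra.Properties.CommutativeSemigroup NP.+-commutativeSemigroup using () renaming (interchange to +-interchange)
open import Algebra.Properties.CommutativeSemigroup (CommutativeRing.+-commutativeSemigroup BP.xor-∧-commutativeRing)
  using () renaming (interchange to xor-interchange)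
open import Data.List using (List; []; _∷_; _++_; map; length)
open import Data.List.Membership.Propositional using (_∈_; _∉_)
open import Data.List.Membership.Propositional.Properties using (∈-∃++; ∈-++⁻; ∈-++⁺ˡ; ∈-++⁺ʳ)
open import Data.List.Relation.Binary.Subset.Propositional using (_⊆_)
import Data.List.Relation.Unary.All as All
open import Data.List.Relation.Unary.All.Properties using (¬Any⇒All¬)
open import Data.List.Relation.Unary.Any using (here; there)
open import Data.List.Relation.Unary.AllPairs using ([]; _∷_)
open import Data.List.Relation.Unary.Unique.Propositional using (Unique)
open import Data.Vec using (Vec; []; _∷_; replicate; zipWith; lookup; toList)
import Data.Vec as Vec
open import Data.Vec.Membership.Propositional.Properties using (∈-toList⁻)
open import Data.Vec.Properties using (length-toList)
open import Data.Vec.Relation.Unary.Any using (index)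
open import Data.Vec.Relation.Unary.Any.Properties using (lookup-index)
open import Data.Fin using (Fin)
open import Data.Nat.Combinatorics using (_C_; nCk+nC[k+1]≡[n+1]C[k+1]; k>n⇒nCk≡0)
open import Data.Nat.Tactic.RingSolver using (solve-∀)
open import Data.Product using (Σ; _×_; _,_; proj₁; proj₂)
open import Data.Sum using (inj₁; inj₂)
open import Data.Empty using (⊥-elim)
open import Function using (_∘_)
open import Relation.Nullary using (yes; no)
open import Relation.Binary.PropositionalEquality

-- Arithmetic of 𝔽₂ⁿ

·-zeroʳ : ∀ {n} (x : 𝔽₂^ n) → x · 𝟎 ≡ false
·-zeroʳ [] = refl
·-zeroʳ (false ∷ x) = ·-zeroʳ x
·-zeroʳ (true ∷ x) = ·-zeroʳ x

·-zeroˡ : ∀ {n} (x : 𝔽₂^ n) → 𝟎 · x ≡ false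
·-zeroˡ [] = refl
·-zeroˡ (_ ∷ x) = ·-zeroˡ x

·-comm : ∀ {n} (x y : 𝔽₂^ n) → x · y ≡ y · x
·-comm [] [] = refl
·-comm (a ∷ x) (b ∷ y) = cong₂ _xor_ (BP.∧-comm a b) (·-comm x y)

·-distribʳ-⊕ : ∀ {n} (x y z : 𝔽₂^ n) → (x ⊕ y) · z ≡ (x · z) xor (y · z)
·-distribʳ-⊕ [] [] [] = refl
·-distribʳ-⊕ (a ∷ x) (b ∷ y) (c ∷ z) = begin
  ((a xor b) ∧ c) xor ((x ⊕ y) · z)            ≡⟨ cong₂ _xor_ (BP.∧-distribʳ-xor c a b) (·-distribʳ-⊕ x y z) ⟩
  ((a ∧ c) xor (b ∧ c)) xor ((x · z) xor (y · z)) ≡⟨ xor-interchange (a ∧ c) (b ∧ c) (x · z) (y · z) ⟩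
  ((a ∧ c) xor (x · z)) xor ((b ∧ c) xor (y · z)) ∎
  where open ≡-Reasoning

·-distribˡ-⊕ : ∀ {n} (x y z : 𝔽₂^ n) → x · (y ⊕ z) ≡ (x · y) xor (x · z)
·-distribˡ-⊕ x y z rewrite ·-comm x (y ⊕ z) | ·-distribʳ-⊕ y z x | ·-comm y x | ·-comm z x = refl

⊕-identityʳ : ∀ {n} (x : 𝔽₂^ n) → x ⊕ 𝟎 ≡ x
⊕-identityʳ [] = refl
⊕-identityʳ (a ∷ x) = cong₂ _∷_ (BP.xor-identityʳ a) (⊕-identityʳ x)

⊕-identityˡ : ∀ {n} (x : 𝔽₂^ n) → 𝟎 ⊕ x ≡ x
⊕-identityˡ [] = refl
⊕-identityˡ (a ∷ x) = cong (a ∷_) (⊕-identityˡ x)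

⊕-self : ∀ {n} (x : 𝔽₂^ n) → x ⊕ x ≡ 𝟎
⊕-self [] = refl
⊕-self (a ∷ x) = cong₂ _∷_ (BP.xor-same a) (⊕-self x)

isZero-𝟎 : ∀ n → isZero (𝟎 {n}) ≡ true
isZero-𝟎 zero = refl
isZero-𝟎 (suc n) = isZero-𝟎 n

isZero⇒≡𝟎 : ∀ {n} (x : 𝔽₂^ n) → isZero x ≡ true → x ≡ 𝟎
isZero⇒≡𝟎 [] _ = refl
isZero⇒≡𝟎 (false ∷ x) eq = cong (false ∷_) (isZero⇒≡𝟎 x eq)

lincomb-zero : ∀ {n r} (v : Vec (𝔽₂^ n) r) → lincomb (replicate r false) v ≡ 𝟎
lincomb-zero [] = refl
lincomb-zero (_ ∷ v) = lincomb-zero v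

pairings : ∀ {n r} → Vec (𝔽₂^ n) r → 𝔽₂^ n → 𝔽₂^ r
pairings [] y = []
pairings (x ∷ v) y = (x · y) ∷ pairings v y

lincomb-· : ∀ {n r} (c : 𝔽₂^ r) (v : Vec (𝔽₂^ n) r) (y : 𝔽₂^ n) → lincomb c v · y ≡ c · pairings v y
lincomb-· [] [] y = ·-zeroˡ y
lincomb-· (false ∷ c) (x ∷ v) y = lincomb-· c v y
lincomb-· (true ∷ c) (x ∷ v) y =
  trans (·-distribʳ-⊕ x (lincomb c v) y) (cong ((x · y) xor_) (lincomb-· c v y))

∈-toList⇒lincomb : ∀ {n r} {v : 𝔽₂^ n} (vs : Vec (𝔽₂^ n) r) → v ∈ toList vs →
  Σ (𝔽₂^ r) (λ c → lincomb c vs ≡ v × c ≢ replicate r false)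
∈-toList⇒lincomb (w ∷ vs) (here refl) =
  true ∷ replicate _ false , trans (cong (w ⊕_) (lincomb-zero vs)) (⊕-identityʳ w) , λ ()
∈-toList⇒lincomb (w ∷ vs) (there v∈vs) with ∈-toList⇒lincomb vs v∈vs
... | c , comb≡v , c≢0 = false ∷ c , comb≡v , λ eq → c≢0 (cong Vec.tail eq)

LinIndep-tail : ∀ {n r} {v : 𝔽₂^ n} {vs : Vec (𝔽₂^ n) r} → LinIndep (v ∷ vs) → LinIndep vs
LinIndep-tail independent c comb≡𝟎 = cong Vec.tail (independent (false ∷ c) comb≡𝟎)

LinIndep⇒𝟎∉ : ∀ {n r} (vs : Vec (𝔽₂^ n) r) → LinIndep vs → 𝟎 ∉ toList vs
LinIndep⇒𝟎∉ vs independent 𝟎∈vs with ∈-toList⇒lincomb vs 𝟎∈vs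
... | c , comb≡𝟎 , c≢0 = c≢0 (independent c comb≡𝟎)

LinIndep⇒Unique : ∀ {n r} (vs : Vec (𝔽₂^ n) r) → LinIndep vs → Unique (toList vs)
LinIndep⇒Unique [] _ = []
LinIndep⇒Unique (v ∷ vs) independent =
  ¬Any⇒All¬ (toList vs) v∉vs ∷ LinIndep⇒Unique vs (LinIndep-tail independent)
  where
  v∉vs : v ∉ toList vs
  v∉vs v∈vs with ∈-toList⇒lincomb vs v∈vs
  ... | c , comb≡v , c≢0 with independent (true ∷ c) (trans (cong (v ⊕_) comb≡v) (⊕-self v))
  ... | ()

zeros : ∀ {r} → 𝔽₂^ r → ℕ
zeros γ = weight (Vec.map not γ)

zeros+weight : ∀ {r} (γ : 𝔽₂^ r) → zeros γ + weight γ ≡ r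
zeros+weight [] = refl
zeros+weight (false ∷ γ) = cong suc (zeros+weight γ)
zeros+weight (true ∷ γ) = trans (NP.+-suc (zeros γ) (weight γ)) (cong suc (zeros+weight γ))

weightOn : ∀ {r} → 𝔽₂^ r → 𝔽₂^ r → ℕ
weightOn α γ = weight (zipWith _∧_ α γ)

weight-split : ∀ {r} (α γ : 𝔽₂^ r) → weight γ ≡ weightOn α γ + weightOn (Vec.map not α) γ
weight-split [] [] = refl
weight-split (a ∷ α) (false ∷ γ) rewrite BP.∧-zeroʳ a | BP.∧-zeroʳ (not a) = weight-split α γ
weight-split (true ∷ α) (true ∷ γ) = cong suc (weight-split α γ)
weight-split (false ∷ α) (true ∷ γ) = trans (cong suc (weight-split α γ)) (sym (NP.+-suc _ _))

even?-suc : ∀ n → even? (suc n) ≡ not (even? n)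
even?-suc zero = refl
even?-suc (suc n) = trans (sym (BP.not-involutive (even? n))) (cong not (sym (even?-suc n)))

·-parity : ∀ {r} (α γ : 𝔽₂^ r) → α · γ ≡ not (even? (weightOn α γ))
·-parity [] [] = refl
·-parity (a ∷ α) (c ∷ γ) with a ∧ c
... | true = trans (cong not (·-parity α γ)) (cong not (sym (even?-suc (weightOn α γ))))
... | false = ·-parity α γ

-- Counting in lists

count-++ : ∀ {A : Set} (p : A → Bool) xs ys → count p (xs ++ ys) ≡ count p xs + count p ys
count-++ p [] ys = refl
count-++ p (x ∷ xs) ys with p x
... | true = cong suc (count-++ p xs ys)
... | false = count-++ p xs ys

count-map : ∀ {A B : Set} (p : B → Bool) (g : A → B) xs → count p (map g xs) ≡ count (λ x → p (g x)) xs
count-map p g [] = refl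
count-map p g (x ∷ xs) with p (g x)
... | true = cong suc (count-map p g xs)
... | false = count-map p g xs

count-cong : ∀ {A : Set} {p q : A → Bool} xs → (∀ x → p x ≡ q x) → count p xs ≡ count q xs
count-cong [] eq = refl
count-cong {q = q} (x ∷ xs) eq rewrite eq x with q x
... | true = cong suc (count-cong xs eq)
... | false = count-cong xs eq

count-≤-length : ∀ {A : Set} (p : A → Bool) xs → count p xs ≤ length xs
count-≤-length p [] = z≤n
count-≤-length p (x ∷ xs) with p x
... | true = s≤s (count-≤-length p xs)
... | false = NP.m≤n⇒m≤1+n (count-≤-length p xs)

count+count-not : ∀ {A : Set} (p : A → Bool) xs → count p xs + count (λ x → not (p x)) xs ≡ length xs
count+count-not p [] = refl
count+count-not p (x ∷ xs) with p x
... | true = cong suc (count+count-not p xs)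
... | false = trans (NP.+-suc _ _) (cong suc (count+count-not p xs))

count-middle : ∀ {A : Set} (p : A → Bool) ys x zs → count p (ys ++ x ∷ zs) ≡ count p (x ∷ ys ++ zs)
count-middle p [] x zs = refl
count-middle p (y ∷ ys) x zs with p y | p x | count-middle p ys x zs
... | true | true | eq = cong suc eq
... | true | false | eq = cong suc eq
... | false | _ | eq = eq

count-∷-mono : ∀ {A : Set} (p : A → Bool) x {xs ys} →
  count p xs ≤ count p ys → count p (x ∷ xs) ≤ count p (x ∷ ys)
count-∷-mono p x le with p x
... | true = s≤s le
... | false = le

count-mono : ∀ {A : Set} (p : A → Bool) {xs ys : List A} → Unique xs → xs ⊆ ys → count p xs ≤ count p ys
count-mono p [] _ = z≤n
count-mono p {x ∷ xs} (x∉xs ∷ xs-unique) xs⊆ys with ∈-∃++ (xs⊆ys (here refl))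
... | ys , zs , refl rewrite count-middle p ys x zs =
  count-∷-mono p x {xs} {ys ++ zs} (count-mono p xs-unique xs⊆ys++zs)
  where
  xs⊆ys++zs : xs ⊆ ys ++ zs
  xs⊆ys++zs y∈xs with ∈-++⁻ ys (xs⊆ys (there y∈xs))
  ... | inj₁ y∈ys = ∈-++⁺ˡ y∈ys
  ... | inj₂ (here refl) = ⊥-elim (All.lookup x∉xs y∈xs refl)
  ... | inj₂ (there y∈zs) = ∈-++⁺ʳ ys y∈zs

-- Both p and its negation can only count more on ys, yet the two counts add up to the same length.
count-⊆-same-length : ∀ {A : Set} (p : A → Bool) {xs ys : List A} → Unique xs → xs ⊆ ys →
  length xs ≡ length ys → count p xs ≡ count p ys
count-⊆-same-length p {xs} {ys} xs-unique xs⊆ys same-length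
  with NP.m≤n⇒m<n∨m≡n (count-mono p xs-unique xs⊆ys)
... | inj₂ eq = eq
... | inj₁ lt = ⊥-elim (NP.<-irrefl totals
  (NP.+-mono-<-≤ lt (count-mono (λ x → not (p x)) xs-unique xs⊆ys)))
  where
  totals : count p xs + count (λ x → not (p x)) xs ≡ count p ys + count (λ x → not (p x)) ys
  totals = trans (count+count-not p xs) (trans same-length (sym (count+count-not p ys)))

≡ᵇ-false : ∀ {m n} → m ≢ n → (m ≡ᵇ n) ≡ false
≡ᵇ-false {m} {n} m≢n with m ≡ᵇ n in eq
... | false = refl
... | true = ⊥-elim (m≢n (NP.≡ᵇ⇒≡ m n (subst T (sym eq) _)))

allL-≡-count : ∀ {A : Set} (p : A → Bool) xs → allL p xs ≡ (count p xs ≡ᵇ length xs)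
allL-≡-count p [] = refl
allL-≡-count p (x ∷ xs) with p x
... | true = allL-≡-count p xs
... | false = sym (≡ᵇ-false (λ eq → NP.<-irrefl eq (s≤s (count-≤-length p xs))))

≡ᵇ-≡-⇔ : ∀ {x y u v} → (x ≡ y → u ≡ v) → (u ≡ v → x ≡ y) → (x ≡ᵇ y) ≡ (u ≡ᵇ v)
≡ᵇ-≡-⇔ {x} {y} {u} {v} to from with x ≡ᵇ y in xy | u ≡ᵇ v in uv
... | true | true = refl
... | false | false = refl
... | true | false = ⊥-elim (subst T uv (NP.≡⇒≡ᵇ u v (to (NP.≡ᵇ⇒≡ x y (subst T (sym xy) _)))))
... | false | true = ⊥-elim (subst T xy (NP.≡⇒≡ᵇ x y (from (NP.≡ᵇ⇒≡ u v (subst T (sym uv) _)))))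

-- Characters of 𝔽₂ʳ and the fibres of y ↦ (sᵢ · y)ᵢ

∑ℤ : (r : ℕ) → (𝔽₂^ r → ℤ) → ℤ
∑ℤ zero f = f []
∑ℤ (suc r) f = ∑ℤ r (λ v → f (false ∷ v)) +ℤ ∑ℤ r (λ v → f (true ∷ v))

∑ℤ-cong : ∀ r {f g : 𝔽₂^ r → ℤ} → (∀ v → f v ≡ g v) → ∑ℤ r f ≡ ∑ℤ r g
∑ℤ-cong zero eq = eq []
∑ℤ-cong (suc r) eq = cong₂ _+ℤ_ (∑ℤ-cong r (λ v → eq (false ∷ v))) (∑ℤ-cong r (λ v → eq (true ∷ v)))

∑ℤ-distrib-+ : ∀ r (f g : 𝔽₂^ r → ℤ) → ∑ℤ r (λ v → f v +ℤ g v) ≡ ∑ℤ r f +ℤ ∑ℤ r g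
∑ℤ-distrib-+ zero f g = refl
∑ℤ-distrib-+ (suc r) f g =
  trans (cong₂ _+ℤ_ (∑ℤ-distrib-+ r (λ v → f (false ∷ v)) (λ v → g (false ∷ v)))
                    (∑ℤ-distrib-+ r (λ v → f (true ∷ v)) (λ v → g (true ∷ v))))
        (+ℤ-interchange (∑ℤ r (λ v → f (false ∷ v))) (∑ℤ r (λ v → g (false ∷ v)))
                        (∑ℤ r (λ v → f (true ∷ v))) (∑ℤ r (λ v → g (true ∷ v))))

∑ℤ-*ʳ : ∀ r (f : 𝔽₂^ r → ℤ) k → ∑ℤ r (λ v → f v *ℤ k) ≡ ∑ℤ r f *ℤ k
∑ℤ-*ʳ zero f k = refl
∑ℤ-*ʳ (suc r) f k =
  trans (cong₂ _+ℤ_ (∑ℤ-*ʳ r (λ v → f (false ∷ v)) k) (∑ℤ-*ʳ r (λ v → f (true ∷ v)) k))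
        (sym (ZP.*-distribʳ-+ k (∑ℤ r (λ v → f (false ∷ v))) (∑ℤ r (λ v → f (true ∷ v)))))

∑ℤ-neg : ∀ r (f : 𝔽₂^ r → ℤ) → ∑ℤ r (λ v → -ℤ f v) ≡ -ℤ ∑ℤ r f
∑ℤ-neg zero f = refl
∑ℤ-neg (suc r) f =
  trans (cong₂ _+ℤ_ (∑ℤ-neg r (λ v → f (false ∷ v))) (∑ℤ-neg r (λ v → f (true ∷ v))))
        (sym (ZP.neg-distrib-+ (∑ℤ r (λ v → f (false ∷ v))) (∑ℤ r (λ v → f (true ∷ v)))))

∑ℤ-zero : ∀ r → ∑ℤ r (λ _ → 0ℤ) ≡ 0ℤ
∑ℤ-zero zero = refl
∑ℤ-zero (suc r) = cong₂ _+ℤ_ (∑ℤ-zero r) (∑ℤ-zero r)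

∑ℤ-comm : ∀ n r (f : 𝔽₂^ n → 𝔽₂^ r → ℤ) → ∑ℤ n (λ y → ∑ℤ r (f y)) ≡ ∑ℤ r (λ c → ∑ℤ n (λ y → f y c))
∑ℤ-comm zero r f = refl
∑ℤ-comm (suc n) r f =
  trans (cong₂ _+ℤ_ (∑ℤ-comm n r (λ y → f (false ∷ y))) (∑ℤ-comm n r (λ y → f (true ∷ y))))
        (sym (∑ℤ-distrib-+ r _ _))

∑ℤ-pick : ∀ r (v : 𝔽₂^ r) (g : 𝔽₂^ r → ℤ) → ∑ℤ r (λ γ → if isZero (v ⊕ γ) then g γ else 0ℤ) ≡ g v
∑ℤ-pick zero [] g = refl
∑ℤ-pick (suc r) (false ∷ v) g =
  trans (cong₂ _+ℤ_ (∑ℤ-pick r v (λ γ → g (false ∷ γ))) (∑ℤ-zero r)) (ZP.+-identityʳ _)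
∑ℤ-pick (suc r) (true ∷ v) g =
  trans (cong₂ _+ℤ_ (∑ℤ-zero r) (∑ℤ-pick r v (λ γ → g (true ∷ γ)))) (ZP.+-identityˡ _)

χ : Bool → ℤ
χ false = 1ℤ
χ true = -1ℤ

χ-xor : ∀ a b → χ (a xor b) ≡ χ a *ℤ χ b
χ-xor false b = sym (ZP.*-identityˡ (χ b))
χ-xor true false = refl
χ-xor true true = refl

χ-not : ∀ b → χ (not b) ≡ -ℤ χ b
χ-not false = refl
χ-not true = refl

orthogonality : ∀ r (δ : 𝔽₂^ r) → ∑ℤ r (λ c → χ (c · δ)) ≡ (if isZero δ then + (2 ^ r) else 0ℤ)
orthogonality zero [] = refl
orthogonality (suc r) (false ∷ δ) with isZero δ | orthogonality r δ
... | true | eq = trans (cong₂ _+ℤ_ eq eq) (cong (λ m → + (2 ^ r + m)) (sym (NP.+-identityʳ (2 ^ r))))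
... | false | eq = cong₂ _+ℤ_ eq eq
orthogonality (suc r) (true ∷ δ) = begin
  Σχ +ℤ ∑ℤ r (λ c → χ (not (c · δ)))       ≡⟨ cong (Σχ +ℤ_) (∑ℤ-cong r (λ c → χ-not (c · δ))) ⟩
  Σχ +ℤ ∑ℤ r (λ c → -ℤ χ (c · δ))          ≡⟨ cong (Σχ +ℤ_) (∑ℤ-neg r (λ c → χ (c · δ))) ⟩
  Σχ +ℤ -ℤ Σχ                              ≡⟨ ZP.+-inverseʳ Σχ ⟩
  0ℤ                                       ∎
  where
  open ≡-Reasoning
  Σχ = ∑ℤ r (λ c → χ (c · δ))

𝟙 : Bool → ℕ
𝟙 false = 0
𝟙 true = 1

if≡𝟙* : ∀ b k → (if b then k else 0ℤ) ≡ + 𝟙 b *ℤ k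
if≡𝟙* false k = refl
if≡𝟙* true k = sym (ZP.*-identityˡ k)

module Fibres {n r : ℕ} (s⃗ : Vec (𝔽₂^ n) r) (s⃗-independent : LinIndep s⃗) where

  isZero-lincomb : ∀ c → isZero (lincomb c s⃗) ≡ isZero c
  isZero-lincomb c with isZero (lincomb c s⃗) in comb≡𝟎 | isZero c in c≡𝟎
  ... | true | true = refl
  ... | false | false = refl
  ... | true | false with () ← trans (sym c≡𝟎) (trans (cong isZero (s⃗-independent c (isZero⇒≡𝟎 _ comb≡𝟎)))
                                                     (isZero-𝟎 r))
  ... | false | true with () ← trans (sym comb≡𝟎) (trans (cong (λ x → isZero (lincomb x s⃗)) (isZero⇒≡𝟎 c c≡𝟎))
                                                        (trans (cong isZero (lincomb-zero s⃗)) (isZero-𝟎 n)))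

  fibreSize : 𝔽₂^ r → ℤ
  fibreSize γ = ∑ℤ n (λ y → + 𝟙 (isZero (pairings s⃗ y ⊕ γ)))

  χ-pairings : ∀ y γ c → χ (c · (pairings s⃗ y ⊕ γ)) ≡ χ (y · lincomb c s⃗) *ℤ χ (c · γ)
  χ-pairings y γ c
    rewrite ·-distribˡ-⊕ c (pairings s⃗ y) γ | sym (lincomb-· c s⃗ y) | ·-comm (lincomb c s⃗) y
    = χ-xor (y · lincomb c s⃗) (c · γ)

  -- Expand the indicator of the fibre into characters of 𝔽₂ʳ; after swapping the sums only c = 0
  -- survives: y ↦ χ (y · lincomb c s⃗) sums to zero unless lincomb c s⃗ = 0, i.e. (by independence) c = 0.
  fibreSize-* : ∀ γ → fibreSize γ *ℤ + (2 ^ r) ≡ + (2 ^ n)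
  fibreSize-* γ = begin
    fibreSize γ *ℤ + (2 ^ r)
      ≡⟨ sym (∑ℤ-*ʳ n (λ y → + 𝟙 (isZero (pairings s⃗ y ⊕ γ))) (+ (2 ^ r))) ⟩
    ∑ℤ n (λ y → + 𝟙 (isZero (pairings s⃗ y ⊕ γ)) *ℤ + (2 ^ r))
      ≡⟨ ∑ℤ-cong n (λ y → trans (sym (if≡𝟙* (isZero (pairings s⃗ y ⊕ γ)) _))
                                (sym (orthogonality r (pairings s⃗ y ⊕ γ)))) ⟩
    ∑ℤ n (λ y → ∑ℤ r (λ c → χ (c · (pairings s⃗ y ⊕ γ))))
      ≡⟨ ∑ℤ-cong n (λ y → ∑ℤ-cong r (χ-pairings y γ)) ⟩
    ∑ℤ n (λ y → ∑ℤ r (λ c → χ (y · lincomb c s⃗) *ℤ χ (c · γ)))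
      ≡⟨ ∑ℤ-comm n r _ ⟩
    ∑ℤ r (λ c → ∑ℤ n (λ y → χ (y · lincomb c s⃗) *ℤ χ (c · γ)))
      ≡⟨ ∑ℤ-cong r (λ c → ∑ℤ-*ʳ n (λ y → χ (y · lincomb c s⃗)) (χ (c · γ))) ⟩
    ∑ℤ r (λ c → ∑ℤ n (λ y → χ (y · lincomb c s⃗)) *ℤ χ (c · γ))
      ≡⟨ ∑ℤ-cong r (λ c → cong (_*ℤ χ (c · γ)) (orthogonality n (lincomb c s⃗))) ⟩
    ∑ℤ r (λ c → (if isZero (lincomb c s⃗) then + (2 ^ n) else 0ℤ) *ℤ χ (c · γ))
      ≡⟨ ∑ℤ-cong r only-zero-survives ⟩
    ∑ℤ r (λ c → if isZero (𝟎 ⊕ c) then + (2 ^ n) *ℤ χ (c · γ) else 0ℤ)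
      ≡⟨ ∑ℤ-pick r 𝟎 (λ c → + (2 ^ n) *ℤ χ (c · γ)) ⟩
    + (2 ^ n) *ℤ χ (𝟎 · γ)
      ≡⟨ cong (λ b → + (2 ^ n) *ℤ χ b) (·-zeroˡ γ) ⟩
    + (2 ^ n) *ℤ 1ℤ
      ≡⟨ ZP.*-identityʳ _ ⟩
    + (2 ^ n) ∎
    where
    open ≡-Reasoning
    only-zero-survives : ∀ c → (if isZero (lincomb c s⃗) then + (2 ^ n) else 0ℤ) *ℤ χ (c · γ)
                               ≡ (if isZero (𝟎 ⊕ c) then + (2 ^ n) *ℤ χ (c · γ) else 0ℤ)
    only-zero-survives c rewrite isZero-lincomb c | ⊕-identityˡ c with isZero c
    ... | true = refl
    ... | false = refl

  ∑ℤ-pairings : ∀ (P : 𝔽₂^ r → Bool) →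
    ∑ℤ n (λ y → + 𝟙 (P (pairings s⃗ y))) *ℤ + (2 ^ r) ≡ ∑ℤ r (λ γ → + 𝟙 (P γ)) *ℤ + (2 ^ n)
  ∑ℤ-pairings P = begin
    ∑ℤ n (λ y → [P] (pairings s⃗ y)) *ℤ + (2 ^ r)
      ≡⟨ cong (_*ℤ + (2 ^ r)) (∑ℤ-cong n (λ y → sym (∑ℤ-pick r (pairings s⃗ y) [P]))) ⟩
    ∑ℤ n (λ y → ∑ℤ r (λ γ → if isZero (pairings s⃗ y ⊕ γ) then [P] γ else 0ℤ)) *ℤ + (2 ^ r)
      ≡⟨ cong (_*ℤ + (2 ^ r)) (∑ℤ-comm n r _) ⟩
    ∑ℤ r (λ γ → ∑ℤ n (λ y → if isZero (pairings s⃗ y ⊕ γ) then [P] γ else 0ℤ)) *ℤ + (2 ^ r)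
      ≡⟨ cong (_*ℤ + (2 ^ r)) (∑ℤ-cong r sum-over-fibre) ⟩
    ∑ℤ r (λ γ → fibreSize γ *ℤ [P] γ) *ℤ + (2 ^ r)
      ≡⟨ sym (∑ℤ-*ʳ r _ (+ (2 ^ r))) ⟩
    ∑ℤ r (λ γ → fibreSize γ *ℤ [P] γ *ℤ + (2 ^ r))
      ≡⟨ ∑ℤ-cong r weigh-fibre ⟩
    ∑ℤ r (λ γ → [P] γ *ℤ + (2 ^ n))
      ≡⟨ ∑ℤ-*ʳ r [P] (+ (2 ^ n)) ⟩
    ∑ℤ r [P] *ℤ + (2 ^ n) ∎
    where
    open ≡-Reasoning
    [P] : 𝔽₂^ r → ℤ
    [P] γ = + 𝟙 (P γ)
    sum-over-fibre : ∀ γ →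
      ∑ℤ n (λ y → if isZero (pairings s⃗ y ⊕ γ) then [P] γ else 0ℤ) ≡ fibreSize γ *ℤ [P] γ
    sum-over-fibre γ = trans (∑ℤ-cong n (λ y → if≡𝟙* (isZero (pairings s⃗ y ⊕ γ)) ([P] γ)))
                             (∑ℤ-*ʳ n _ ([P] γ))
    weigh-fibre : ∀ γ → fibreSize γ *ℤ [P] γ *ℤ + (2 ^ r) ≡ [P] γ *ℤ + (2 ^ n)
    weigh-fibre γ = begin
      fibreSize γ *ℤ [P] γ *ℤ + (2 ^ r)   ≡⟨ ZP.*-assoc (fibreSize γ) ([P] γ) _ ⟩
      fibreSize γ *ℤ ([P] γ *ℤ + (2 ^ r)) ≡⟨ cong (fibreSize γ *ℤ_) (ZP.*-comm ([P] γ) _) ⟩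
      fibreSize γ *ℤ (+ (2 ^ r) *ℤ [P] γ) ≡⟨ sym (ZP.*-assoc (fibreSize γ) _ ([P] γ)) ⟩
      fibreSize γ *ℤ + (2 ^ r) *ℤ [P] γ   ≡⟨ cong (_*ℤ [P] γ) (fibreSize-* γ) ⟩
      + (2 ^ n) *ℤ [P] γ                  ≡⟨ ZP.*-comm _ ([P] γ) ⟩
      [P] γ *ℤ + (2 ^ n)                  ∎

count-allVec-suc : ∀ r (p : 𝔽₂^ (suc r) → Bool) →
  count p (allVec (suc r)) ≡ count (λ v → p (false ∷ v)) (allVec r) + count (λ v → p (true ∷ v)) (allVec r)
count-allVec-suc r p =
  trans (count-++ p (map (false ∷_) (allVec r)) (map (true ∷_) (allVec r)))
        (cong₂ _+_ (count-map p (false ∷_) (allVec r)) (count-map p (true ∷_) (allVec r)))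

count-allVec : ∀ r (p : 𝔽₂^ r → Bool) → + count p (allVec r) ≡ ∑ℤ r (λ v → + 𝟙 (p v))
count-allVec zero p with p []
... | true = refl
... | false = refl
count-allVec (suc r) p = begin
  + count p (allVec (suc r))
    ≡⟨ cong +_ (count-allVec-suc r p) ⟩
  + (count (λ v → p (false ∷ v)) (allVec r) + count (λ v → p (true ∷ v)) (allVec r))
    ≡⟨ ZP.pos-+ (count (λ v → p (false ∷ v)) (allVec r)) (count (λ v → p (true ∷ v)) (allVec r)) ⟩
  + count (λ v → p (false ∷ v)) (allVec r) +ℤ + count (λ v → p (true ∷ v)) (allVec r)
    ≡⟨ cong₂ _+ℤ_ (count-allVec r (λ v → p (false ∷ v))) (count-allVec r (λ v → p (true ∷ v))) ⟩
  ∑ℤ (suc r) (λ v → + 𝟙 (p v)) ∎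
  where open ≡-Reasoning

count-isZero : ∀ r → count isZero (allVec r) ≡ 1
count-isZero zero = refl
count-isZero (suc r) =
  trans (count-allVec-suc r isZero) (cong₂ _+_ (count-isZero r) (nothing-starts-with-true (allVec r)))
  where
  nothing-starts-with-true : ∀ (vs : List (𝔽₂^ r)) → count (λ v → isZero (true ∷ v)) vs ≡ 0
  nothing-starts-with-true [] = refl
  nothing-starts-with-true (_ ∷ vs) = nothing-starts-with-true vs

-- Every γ ∈ 𝔽₂ʳ has exactly 2ⁿ⁻ʳ preimages under y ↦ pairings s⃗ y.
count-pairings : ∀ {n r} (s⃗ : Vec (𝔽₂^ n) r) → LinIndep s⃗ → (P : 𝔽₂^ r → Bool) →
  count (λ y → P (pairings s⃗ y)) (allVec n) * 2 ^ r ≡ count P (allVec r) * 2 ^ n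
count-pairings {n} {r} s⃗ s⃗-independent P = ZP.+-injective (begin
  + (count (λ y → P (pairings s⃗ y)) (allVec n) * 2 ^ r)
    ≡⟨ ZP.pos-* (count (λ y → P (pairings s⃗ y)) (allVec n)) (2 ^ r) ⟩
  + count (λ y → P (pairings s⃗ y)) (allVec n) *ℤ + (2 ^ r)
    ≡⟨ cong (_*ℤ + (2 ^ r)) (count-allVec n _) ⟩
  ∑ℤ n (λ y → + 𝟙 (P (pairings s⃗ y))) *ℤ + (2 ^ r)
    ≡⟨ Fibres.∑ℤ-pairings s⃗ s⃗-independent P ⟩
  ∑ℤ r (λ γ → + 𝟙 (P γ)) *ℤ + (2 ^ n)
    ≡⟨ cong (_*ℤ + (2 ^ n)) (sym (count-allVec r P)) ⟩
  + count P (allVec r) *ℤ + (2 ^ n)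
    ≡⟨ sym (ZP.pos-* (count P (allVec r)) (2 ^ n)) ⟩
  + (count P (allVec r) * 2 ^ n) ∎)
  where open ≡-Reasoning

-- Balanced and constant directions of S

𝟙-not-· : ∀ {r} (α γ : 𝔽₂^ r) → 𝟙 (not (α · γ)) ≡ e (weightOn α γ)
𝟙-not-· α γ rewrite ·-parity α γ | BP.not-involutive (even? (weightOn α γ)) with even? (weightOn α γ)
... | true = refl
... | false = refl

if-suc≡𝟙+ : ∀ b z → (if b then suc z else z) ≡ 𝟙 b + z
if-suc≡𝟙+ false z = refl
if-suc≡𝟙+ true z = refl

double-suc-≡ᵇ : ∀ x h → (2 * suc x ≡ᵇ h + h + 2) ≡ (x ≡ᵇ h)
double-suc-≡ᵇ x h = ≡ᵇ-≡-⇔ to from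
  where
  h+h+2≡2*suc-h : h + h + 2 ≡ 2 * suc h
  h+h+2≡2*suc-h = identity h
    where
    identity : ∀ h → h + h + 2 ≡ 2 * suc h
    identity = solve-∀
  to : 2 * suc x ≡ h + h + 2 → x ≡ h
  to eq = NP.suc-injective (NP.*-cancelˡ-≡ (suc x) (suc h) 2 (trans eq h+h+2≡2*suc-h))
  from : x ≡ h → 2 * suc x ≡ h + h + 2
  from refl = sym h+h+2≡2*suc-h

complement-≡ᵇ : ∀ {h b z w} → z + w ≡ h + h → (b + z ≡ᵇ h) ≡ (w ≡ᵇ h + b)
complement-≡ᵇ {h} {b} {z} {w} z+w≡h+h = ≡ᵇ-≡-⇔ to from
  where
  rearrange : (b + z) + h ≡ z + (h + b)
  rearrange = identity b z h
    where
    identity : ∀ b z h → (b + z) + h ≡ z + (h + b)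
    identity = solve-∀
  to : b + z ≡ h → w ≡ h + b
  to eq = NP.+-cancelˡ-≡ z w (h + b) (trans z+w≡h+h (trans (cong (_+ h) (sym eq)) rearrange))
  from : w ≡ h + b → b + z ≡ h
  from eq = NP.+-cancelʳ-≡ h (b + z) h (trans rearrange (trans (cong (λ x → z + x) (sym eq)) z+w≡h+h))

count-inH-toList : ∀ {n r} (y : 𝔽₂^ n) (v : Vec (𝔽₂^ n) r) → count (inH y) (toList v) ≡ zeros (pairings v y)
count-inH-toList y [] = refl
count-inH-toList y (x ∷ v) with x · y
... | true = count-inH-toList y v
... | false = cong suc (count-inH-toList y v)

allL-inH-toList : ∀ {n r} (y : 𝔽₂^ n) (v : Vec (𝔽₂^ n) r) → allL (inH y) (toList v) ≡ isZero (pairings v y)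
allL-inH-toList y [] = refl
allL-inH-toList y (x ∷ v) = cong (not (x · y) ∧_) (allL-inH-toList y v)

count-inH-𝟎 : ∀ {n} (xs : List (𝔽₂^ n)) → count (inH 𝟎) xs ≡ length xs
count-inH-𝟎 [] = refl
count-inH-𝟎 (x ∷ xs) rewrite ·-zeroʳ x = cong suc (count-inH-𝟎 xs)

balancedPattern : ∀ {r} → ℕ → 𝔽₂^ r → 𝔽₂^ r → Bool
balancedPattern h α γ = weight γ ≡ᵇ h + e (weightOn α γ)

module Setting {n r : ℕ} (S : List (𝔽₂^ n)) (𝟎∈S : 𝟎 ∈ S) (length-S : length S ≡ r + 2)
  (s⃗ : Vec (𝔽₂^ n) r) (s⃗⊆S : (i : Fin r) → lookup s⃗ i ∈ S) (s⃗-independent : LinIndep s⃗)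
  (s : 𝔽₂^ n) (s∈S : s ∈ S) (s≢𝟎 : s ≢ 𝟎) (s≢s⃗ : (i : Fin r) → s ≢ lookup s⃗ i)
  (α : 𝔽₂^ r) (α-s : lincomb α s⃗ ≡ s) where

  L : List (𝔽₂^ n)
  L = 𝟎 ∷ s ∷ toList s⃗

  L-unique : Unique L
  L-unique =
    ¬Any⇒All¬ (s ∷ toList s⃗) 𝟎∉ ∷ ¬Any⇒All¬ (toList s⃗) s∉s⃗ ∷ LinIndep⇒Unique s⃗ s⃗-independent
    where
    𝟎∉ : 𝟎 ∉ s ∷ toList s⃗
    𝟎∉ (here 𝟎≡s) = s≢𝟎 (sym 𝟎≡s)
    𝟎∉ (there 𝟎∈s⃗) = LinIndep⇒𝟎∉ s⃗ s⃗-independent 𝟎∈s⃗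
    s∉s⃗ : s ∉ toList s⃗
    s∉s⃗ s∈s⃗ = s≢s⃗ _ (lookup-index (∈-toList⁻ s∈s⃗))

  L⊆S : L ⊆ S
  L⊆S (here refl) = 𝟎∈S
  L⊆S (there (here refl)) = s∈S
  L⊆S (there (there x∈s⃗)) = subst (_∈ S) (sym (lookup-index x∈ᵥs⃗)) (s⃗⊆S (index x∈ᵥs⃗))
    where x∈ᵥs⃗ = ∈-toList⁻ x∈s⃗

  length-L : length L ≡ length S
  length-L = trans (cong (suc ∘ suc) (length-toList s⃗)) (trans (NP.+-comm 2 r) (sym length-S))

  count-S : ∀ p → count p S ≡ count p L
  count-S p = sym (count-⊆-same-length p L-unique L⊆S length-L)

  allL-S : ∀ p → allL p S ≡ allL p L
  allL-S p rewrite allL-≡-count p S | allL-≡-count p L | count-S p | length-L = refl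

  inH-s : ∀ y → inH y s ≡ not (α · pairings s⃗ y)
  inH-s y = cong not (trans (cong (_· y) (sym α-s)) (lincomb-· α s⃗ y))

  constant?-S : ∀ y → constant? S y ≡ isZero (pairings s⃗ y)
  constant?-S y rewrite allL-S (inH y) | allL-S (λ x → not (inH y x)) | ·-zeroˡ y | inH-s y
                      | allL-inH-toList y s⃗ | BP.∨-identityʳ (not (α · pairings s⃗ y) ∧ isZero (pairings s⃗ y))
    with isZero (pairings s⃗ y) in γ≡𝟎
  ... | false = BP.∧-zeroʳ _
  ... | true = cong (λ b → not b ∧ true) (trans (cong (α ·_) (isZero⇒≡𝟎 _ γ≡𝟎)) (·-zeroʳ α))

  #S∩H-S : ∀ y → #S∩H S y ≡ suc (e (weightOn α (pairings s⃗ y)) + zeros (pairings s⃗ y))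
  #S∩H-S y rewrite count-S (inH y) | ·-zeroˡ y | inH-s y | count-inH-toList y s⃗
    = cong suc (trans (if-suc≡𝟙+ (not (α · pairings s⃗ y)) (zeros (pairings s⃗ y)))
                      (cong (_+ zeros (pairings s⃗ y)) (𝟙-not-· α (pairings s⃗ y))))

  balanced?-S : ∀ {h} → r ≡ h + h → ∀ y → balanced? S y ≡ balancedPattern h α (pairings s⃗ y)
  balanced?-S {h} r≡h+h y = begin
    (2 * #S∩H S y ≡ᵇ length S)
      ≡⟨ cong₂ (λ a b → 2 * a ≡ᵇ b) (#S∩H-S y) (trans length-S (cong (_+ 2) r≡h+h)) ⟩
    (2 * suc (e w + zeros γ) ≡ᵇ h + h + 2)
      ≡⟨ double-suc-≡ᵇ (e w + zeros γ) h ⟩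
    (e w + zeros γ ≡ᵇ h)
      ≡⟨ complement-≡ᵇ {h} {e w} {zeros γ} {weight γ} (trans (zeros+weight γ) r≡h+h) ⟩
    (weight γ ≡ᵇ h + e w) ∎
    where
    open ≡-Reasoning
    γ = pairings s⃗ y
    w = weightOn α γ

  𝟎-unbalanced : balanced? S 𝟎 ≡ false
  𝟎-unbalanced rewrite count-inH-𝟎 S | trans length-S (NP.+-comm r 2) =
    ≡ᵇ-false (λ eq → NP.<-irrefl (sym eq) (subst (suc (suc r) <_) (NP.*-comm (suc (suc r)) 2)
                                                 (NP.m<m*n (suc (suc r)) 2 (s≤s (s≤s z≤n)))))

  nonzero-balanced?-S : ∀ {h} → r ≡ h + h → ∀ y →
    (not (isZero y) ∧ balanced? S y) ≡ balancedPattern h α (pairings s⃗ y)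
  nonzero-balanced?-S {h} r≡h+h y with isZero y in y≡𝟎
  ... | false = balanced?-S r≡h+h y
  ... | true = begin
    false                                    ≡⟨ sym 𝟎-unbalanced ⟩
    balanced? S 𝟎                            ≡⟨ balanced?-S r≡h+h 𝟎 ⟩
    balancedPattern h α (pairings s⃗ 𝟎)       ≡⟨ cong (balancedPattern h α ∘ pairings s⃗) (sym (isZero⇒≡𝟎 y y≡𝟎)) ⟩
    balancedPattern h α (pairings s⃗ y)       ∎
    where open ≡-Reasoning

  #C-S : #C S * 2 ^ r ≡ 2 ^ n
  #C-S = begin
    #C S * 2 ^ r                                           ≡⟨ cong (_* 2 ^ r) (count-cong (allVec n) constant?-S) ⟩
    count (λ y → isZero (pairings s⃗ y)) (allVec n) * 2 ^ r ≡⟨ count-pairings s⃗ s⃗-independent isZero ⟩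
    count isZero (allVec r) * 2 ^ n                        ≡⟨ cong (_* 2 ^ n) (count-isZero r) ⟩
    1 * 2 ^ n                                              ≡⟨ NP.*-identityˡ (2 ^ n) ⟩
    2 ^ n                                                  ∎
    where open ≡-Reasoning

  #B-S : ∀ {h} → r ≡ h + h → #B S * 2 ^ r ≡ count (balancedPattern h α) (allVec r) * 2 ^ n
  #B-S {h} r≡h+h =
    trans (cong (_* 2 ^ r) (count-cong (allVec n) (nonzero-balanced?-S r≡h+h)))
          (count-pairings s⃗ s⃗-independent (balancedPattern h α))

-- Counting balanced patterns

∑< : ℕ → (ℕ → ℕ) → ℕ
∑< zero f = 0
∑< (suc N) f = f 0 + ∑< N (λ i → f (suc i))

∑<-cong : ∀ N {f g : ℕ → ℕ} → (∀ i → f i ≡ g i) → ∑< N f ≡ ∑< N g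
∑<-cong zero eq = refl
∑<-cong (suc N) eq = cong₂ _+_ (eq 0) (∑<-cong N (λ i → eq (suc i)))

∑<-distrib-+ : ∀ N (f g : ℕ → ℕ) → ∑< N (λ i → f i + g i) ≡ ∑< N f + ∑< N g
∑<-distrib-+ zero f g = refl
∑<-distrib-+ (suc N) f g =
  trans (cong (λ x → f 0 + g 0 + x) (∑<-distrib-+ N (λ i → f (suc i)) (λ i → g (suc i))))
        (+-interchange (f 0) (g 0) (∑< N (λ i → f (suc i))) (∑< N (λ i → g (suc i))))

∑<-zero : ∀ N (f : ℕ → ℕ) → (∀ i → f i ≡ 0) → ∑< N f ≡ 0
∑<-zero zero f f≡0 = refl
∑<-zero (suc N) f f≡0 = cong₂ _+_ (f≡0 0) (∑<-zero N (λ i → f (suc i)) (λ i → f≡0 (suc i)))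

∑<-snoc : ∀ N (f : ℕ → ℕ) → ∑< (suc N) f ≡ ∑< N f + f N
∑<-snoc zero f = NP.+-identityʳ (f 0)
∑<-snoc (suc N) f = trans (cong (λ x → f 0 + x) (∑<-snoc N (λ i → f (suc i)))) (sym (NP.+-assoc (f 0) _ _))

∑<-pascal : ∀ k (H : ℕ → ℕ) →
  ∑< (suc (suc k)) (λ a → (suc k C a) * H a)
  ≡ ∑< (suc k) (λ a → (k C a) * H a) + ∑< (suc k) (λ a → (k C a) * H (suc a))
∑<-pascal k H = begin
  H 0 + 0 + ∑< (suc k) (λ a → (suc k C suc a) * H (suc a))
    ≡⟨ cong (λ x → H 0 + 0 + x) (∑<-cong (suc k) (λ a → cong (_* H (suc a)) (sym (nCk+nC[k+1]≡[n+1]C[k+1] k a)))) ⟩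
  H 0 + 0 + ∑< (suc k) (λ a → ((k C a) + (k C suc a)) * H (suc a))
    ≡⟨ cong (λ x → H 0 + 0 + x) (trans (∑<-cong (suc k) (λ a → NP.*-distribʳ-+ (H (suc a)) (k C a) (k C suc a)))
                                (∑<-distrib-+ (suc k) (λ a → (k C a) * H (suc a)) (λ a → (k C suc a) * H (suc a)))) ⟩
  H 0 + 0 + (B + ∑< (suc k) (λ a → (k C suc a) * H (suc a)))
    ≡⟨ cong (λ x → H 0 + 0 + (B + x)) (∑<-snoc k (λ a → (k C suc a) * H (suc a))) ⟩
  H 0 + 0 + (B + (A + (k C suc k) * H (suc k)))
    ≡⟨ cong (λ x → H 0 + 0 + (B + (A + x * H (suc k)))) (k>n⇒nCk≡0 (NP.n<1+n k)) ⟩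
  H 0 + 0 + (B + (A + 0))
    ≡⟨ cong (λ x → H 0 + 0 + (B + x)) (NP.+-identityʳ A) ⟩
  H 0 + 0 + (B + A)
    ≡⟨ cong (λ x → H 0 + 0 + x) (NP.+-comm B A) ⟩
  H 0 + 0 + (A + B)
    ≡⟨ sym (NP.+-assoc (H 0 + 0) A B) ⟩
  H 0 + 0 + A + B ∎
  where
  open ≡-Reasoning
  A = ∑< k (λ a → (k C suc a) * H (suc a))
  B = ∑< (suc k) (λ a → (k C a) * H (suc a))

count-by-weightOn : ∀ {r} (α : 𝔽₂^ r) (P : ℕ → ℕ → Bool) →
  let k = weight α
      m = weight (Vec.map not α)
  in count (λ γ → P (weightOn α γ) (weightOn (Vec.map not α) γ)) (allVec r)
     ≡ ∑< (suc k) (λ a → (k C a) * ∑< (suc m) (λ c → (m C c) * 𝟙 (P a c)))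
count-by-weightOn [] P with P 0 0
... | true = refl
... | false = refl
count-by-weightOn {suc r} (true ∷ α) P = begin
  count (λ γ → P (weightOn (true ∷ α) γ) (weightOn (Vec.map not (true ∷ α)) γ)) (allVec (suc r))
    ≡⟨ count-allVec-suc r _ ⟩
  count (λ γ → P (weightOn α γ) (weightOn ᾱ γ)) (allVec r)
    + count (λ γ → P (suc (weightOn α γ)) (weightOn ᾱ γ)) (allVec r)
    ≡⟨ cong₂ _+_ (count-by-weightOn α P) (count-by-weightOn α (λ a → P (suc a))) ⟩
  ∑< (suc k) (λ a → (k C a) * H a) + ∑< (suc k) (λ a → (k C a) * H (suc a))
    ≡⟨ sym (∑<-pascal k H) ⟩
  ∑< (suc (suc k)) (λ a → (suc k C a) * H a) ∎
  where
  open ≡-Reasoning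
  ᾱ = Vec.map not α
  k = weight α
  m = weight ᾱ
  H : ℕ → ℕ
  H a = ∑< (suc m) (λ c → (m C c) * 𝟙 (P a c))
count-by-weightOn {suc r} (false ∷ α) P = begin
  count (λ γ → P (weightOn (false ∷ α) γ) (weightOn (Vec.map not (false ∷ α)) γ)) (allVec (suc r))
    ≡⟨ count-allVec-suc r _ ⟩
  count (λ γ → P (weightOn α γ) (weightOn ᾱ γ)) (allVec r)
    + count (λ γ → P (weightOn α γ) (suc (weightOn ᾱ γ))) (allVec r)
    ≡⟨ cong₂ _+_ (count-by-weightOn α P) (count-by-weightOn α (λ a c → P a (suc c))) ⟩
  ∑< (suc k) (λ a → (k C a) * H a) + ∑< (suc k) (λ a → (k C a) * H′ a)
    ≡⟨ sym (∑<-distrib-+ (suc k) (λ a → (k C a) * H a) (λ a → (k C a) * H′ a)) ⟩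
  ∑< (suc k) (λ a → (k C a) * H a + (k C a) * H′ a)
    ≡⟨ ∑<-cong (suc k) (λ a → trans (sym (NP.*-distribˡ-+ (k C a) (H a) (H′ a)))
                                     (cong ((k C a) *_) (sym (∑<-pascal m (λ c → 𝟙 (P a c)))))) ⟩
  ∑< (suc k) (λ a → (k C a) * ∑< (suc (suc m)) (λ c → (suc m C c) * 𝟙 (P a c))) ∎
  where
  open ≡-Reasoning
  ᾱ = Vec.map not α
  k = weight α
  m = weight ᾱ
  H H′ : ℕ → ℕ
  H a = ∑< (suc m) (λ c → (m C c) * 𝟙 (P a c))
  H′ a = ∑< (suc m) (λ c → (m C c) * 𝟙 (P a (suc c)))

∑<-select : ∀ N t (g : ℕ → ℕ) → (∀ i → N ≤ i → g i ≡ 0) → ∑< N (λ c → g c * 𝟙 (c ≡ᵇ t)) ≡ g t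
∑<-select zero t g g≡0 = sym (g≡0 t z≤n)
∑<-select (suc N) zero g g≡0 =
  trans (cong₂ _+_ (NP.*-identityʳ (g 0)) (∑<-zero N _ (λ i → NP.*-zeroʳ (g (suc i))))) (NP.+-identityʳ (g 0))
∑<-select (suc N) (suc t) g g≡0 =
  trans (cong (_+ ∑< N (λ c → g (suc c) * 𝟙 (c ≡ᵇ t))) (NP.*-zeroʳ (g 0)))
        (∑<-select N t (g ∘ suc) (λ i N≤i → g≡0 (suc i) (s≤s N≤i)))

binomℤ-diff-≥ : ∀ m {a j} → a ≤ j → binomℤ m (+ j -ℤ + a) ≡ m C (j ∸ a)
binomℤ-diff-≥ m {a} {j} a≤j = cong (binomℤ m) (trans (ZP.m-n≡m⊖n j a) (ZP.⊖-≥ a≤j))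

binomℤ-diff-< : ∀ m {a j} → j < a → binomℤ m (+ j -ℤ + a) ≡ 0
binomℤ-diff-< m {a} {j} j<a rewrite ZP.m-n≡m⊖n j a | ZP.⊖-< j<a with a ∸ j | NP.m>n⇒m∸n≢0 j<a
... | zero | a∸j≢0 = ⊥-elim (a∸j≢0 refl)
... | suc _ | _ = refl

∑<-binomial-select : ∀ m a j → ∑< (suc m) (λ c → (m C c) * 𝟙 (a + c ≡ᵇ j)) ≡ binomℤ m (+ j -ℤ + a)
∑<-binomial-select m a j with a ≤? j
... | yes a≤j = begin
  ∑< (suc m) (λ c → (m C c) * 𝟙 (a + c ≡ᵇ j))
    ≡⟨ ∑<-cong (suc m) (λ c → cong (λ b → (m C c) * 𝟙 b) (≡ᵇ-≡-⇔ (to c) (from c))) ⟩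
  ∑< (suc m) (λ c → (m C c) * 𝟙 (c ≡ᵇ j ∸ a))
    ≡⟨ ∑<-select (suc m) (j ∸ a) (m C_) (λ i m<i → k>n⇒nCk≡0 m<i) ⟩
  m C (j ∸ a)
    ≡⟨ sym (binomℤ-diff-≥ m a≤j) ⟩
  binomℤ m (+ j -ℤ + a) ∎
  where
  open ≡-Reasoning
  to : ∀ c → a + c ≡ j → c ≡ j ∸ a
  to c refl = sym (NP.m+n∸m≡n a c)
  from : ∀ c → c ≡ j ∸ a → a + c ≡ j
  from c refl = NP.m+[n∸m]≡n a≤j
... | no a≰j =
  trans (∑<-zero (suc m) _ (λ c → trans (cong (λ b → (m C c) * 𝟙 b) (≡ᵇ-false (a+c≢j c))) (NP.*-zeroʳ (m C c))))
        (sym (binomℤ-diff-< m (NP.≰⇒> a≰j)))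
  where
  a+c≢j : ∀ c → a + c ≢ j
  a+c≢j c a+c≡j = a≰j (subst (a ≤_) a+c≡j (NP.m≤m+n a c))

-- φ′ (r / 2) and term′ (r / 2) r are φ r and term r by definition; abstracting r / 2 lets them be studied
-- for r = h + h.
term′ : ℕ → ℕ → ℕ → ℕ → ℕ
term′ h r k i = (k C i) * binomℤ (r ∸ k) ((+ h +ℤ + e i) -ℤ + i)

φ′ : ℕ → ℕ → ℕ × ℕ
φ′ h k = if k <ᵇ h then (0 , k)
         else if k ≡ᵇ h then (1 , k)
         else (k ∸ h + e (k ∸ h) , h + e (h + 1))

count-balancedPattern : ∀ h {r} (α : 𝔽₂^ r) →
  count (balancedPattern h α) (allVec r) ≡ ∑< (suc (weight α)) (term′ h r (weight α))
count-balancedPattern h {r} α = begin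
  count (balancedPattern h α) (allVec r)
    ≡⟨ count-cong (allVec r) (λ γ → cong (_≡ᵇ h + e (weightOn α γ)) (weight-split α γ)) ⟩
  count (λ γ → P (weightOn α γ) (weightOn ᾱ γ)) (allVec r)
    ≡⟨ count-by-weightOn α P ⟩
  ∑< (suc k) (λ a → (k C a) * ∑< (suc m) (λ c → (m C c) * 𝟙 (P a c)))
    ≡⟨ ∑<-cong (suc k) (λ a → cong ((k C a) *_) (∑<-binomial-select m a (h + e a))) ⟩
  ∑< (suc k) (λ a → (k C a) * binomℤ m (+ (h + e a) -ℤ + a))
    ≡⟨ ∑<-cong (suc k) (λ a → cong (λ x → (k C a) * binomℤ x (+ (h + e a) -ℤ + a)) (sym r∸k≡m)) ⟩
  ∑< (suc k) (term′ h r k) ∎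
  where
  open ≡-Reasoning
  ᾱ = Vec.map not α
  k = weight α
  m = weight ᾱ
  P : ℕ → ℕ → Bool
  P a c = a + c ≡ᵇ h + e a
  r∸k≡m : r ∸ k ≡ m
  r∸k≡m = trans (cong (_∸ k) (sym (zeros+weight α))) (NP.m+n∸n≡m m k)

-- Restricting the sum to [φ₁, φ₂]

sumRange-∑< : ∀ a b f → sumRange a b f ≡ ∑< (suc b ∸ a) (λ t → f (a + t))
sumRange-∑< zero zero f = refl
sumRange-∑< (suc a) zero f rewrite NP.0∸n≡0 a = refl
sumRange-∑< a (suc b) f with a ≤? suc b
... | no a≰1+b rewrite NP.m≤n⇒m∸n≡0 (NP.≰⇒> a≰1+b) = refl
... | yes a≤1+b rewrite NP.+-∸-assoc 1 a≤1+b =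
  trans (cong (λ x → f (a + (suc b ∸ a)) + x) (sumRange-∑< a b f))
        (trans (NP.+-comm (f (a + (suc b ∸ a))) _) (sym (∑<-snoc (suc b ∸ a) (λ t → f (a + t)))))

∑<-truncate : ∀ M N (f : ℕ → ℕ) → M ≤ N → (∀ i → M ≤ i → f i ≡ 0) → ∑< N f ≡ ∑< M f
∑<-truncate zero N f _ f≡0 = ∑<-zero N f (λ i → f≡0 i z≤n)
∑<-truncate (suc M) (suc N) f (s≤s M≤N) f≡0 =
  cong (λ x → f 0 + x) (∑<-truncate M N (f ∘ suc) M≤N (λ i M≤i → f≡0 (suc i) (s≤s M≤i)))

∑<-drop : ∀ a N (f : ℕ → ℕ) → (∀ i → i < a → f i ≡ 0) → ∑< N f ≡ ∑< (N ∸ a) (λ t → f (a + t))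
∑<-drop zero N f _ = refl
∑<-drop (suc a) zero f _ = refl
∑<-drop (suc a) (suc N) f f≡0 rewrite f≡0 0 (s≤s z≤n) =
  ∑<-drop a N (f ∘ suc) (λ i i<a → f≡0 (suc i) (s≤s i<a))

∑<-support : ∀ (f : ℕ → ℕ) a b k →
  (∀ i → i < a → f i ≡ 0) → (∀ i → b < i → f i ≡ 0) → (∀ i → k < i → f i ≡ 0) →
  ∑< (suc k) f ≡ sumRange a b f
∑<-support f a b k below-a above-b above-k = begin
  ∑< (suc k) f             ≡⟨ sym (∑<-truncate (suc k) (suc k + suc b) f (NP.m≤m+n (suc k) (suc b)) above-k) ⟩
  ∑< (suc k + suc b) f     ≡⟨ ∑<-truncate (suc b) (suc k + suc b) f (NP.m≤n+m (suc b) (suc k)) above-b ⟩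
  ∑< (suc b) f             ≡⟨ ∑<-drop a (suc b) f below-a ⟩
  ∑< (suc b ∸ a) (λ t → f (a + t)) ≡⟨ sym (sumRange-∑< a b f) ⟩
  sumRange a b f           ∎
  where open ≡-Reasoning

sumRange-empty : ∀ {a b} f → b < a → sumRange a b f ≡ 0
sumRange-empty f b<a rewrite NP.m≤n⇒m∸n≡0 b<a = refl

e≤1 : ∀ n → e n ≤ 1
e≤1 n with even? n
... | true = s≤s z≤n
... | false = z≤n

term′-above : ∀ h r k i → k < i → term′ h r k i ≡ 0
term′-above h r k i k<i rewrite k>n⇒nCk≡0 k<i = refl

term′-negative : ∀ h r k i → h + e i < i → term′ h r k i ≡ 0
term′-negative h r k i h+e<i = trans (cong ((k C i) *_) (binomℤ-diff-< (r ∸ k) h+e<i)) (NP.*-zeroʳ (k C i))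

term′-overfull : ∀ h r k i → i + (r ∸ k) < h + e i → term′ h r k i ≡ 0
term′-overfull h r k i overfull = trans (cong ((k C i) *_) binom≡0) (NP.*-zeroʳ (k C i))
  where
  i≤h+e : i ≤ h + e i
  i≤h+e = NP.≤-trans (NP.m≤m+n i (r ∸ k)) (NP.<⇒≤ overfull)
  binom≡0 : binomℤ (r ∸ k) (+ (h + e i) -ℤ + i) ≡ 0
  binom≡0 = trans (binomℤ-diff-≥ (r ∸ k) i≤h+e)
                  (k>n⇒nCk≡0 (NP.+-cancelˡ-< i (r ∸ k) (h + e i ∸ i)
                                (subst (i + (r ∸ k) <_) (sym (NP.m+[n∸m]≡n i≤h+e)) overfull)))

term′-beyond-upper : ∀ h r k i → h + e (h + 1) < i → term′ h r k i ≡ 0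
term′-beyond-upper h r k i upper<i = term′-negative h r k i h+e<i
  where
  h<i : suc h ≤ i
  h<i = NP.≤-<-trans (NP.m≤m+n h (e (h + 1))) upper<i
  h+e<i : h + e i < i
  h+e<i with NP.m≤n⇒m<n∨m≡n h<i
  ... | inj₁ 1+h<i = NP.≤-<-trans (NP.+-monoʳ-≤ h (e≤1 i)) (subst (_< i) (NP.+-comm 1 h) 1+h<i)
  ... | inj₂ refl = subst (λ j → h + e j < suc h) (NP.+-comm h 1) upper<i

-- For k = h + d and r ∸ k = q (so h = d + q), the summands with i < d + e d vanish.
below-lower : ∀ d q i → i < d + e d → i + q < d + q + e i
below-lower d q i i<lower with i <? d
... | yes i<d = NP.<-≤-trans (NP.+-monoˡ-< q i<d) (NP.m≤m+n (d + q) (e i))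
... | no i≮d with even? d in d-even
... | false = ⊥-elim (i≮d (subst (i <_) (NP.+-identityʳ d) i<lower))
... | true with NP.≤-antisym (NP.≮⇒≥ i≮d) (NP.≤-pred (subst (suc i ≤_) (NP.+-comm d 1) i<lower))
... | refl rewrite d-even = subst (i + q <_) (sym (NP.+-comm (i + q) 1)) (NP.n<1+n (i + q))

∸-halves : ∀ {h k} → h ≤ k → k ≤ h + h → (k ∸ h) + (h + h ∸ k) ≡ h
∸-halves {h} {k} h≤k k≤h+h = begin
  d + (h + h ∸ k)       ≡⟨ cong (λ x → d + (h + h ∸ x)) (sym h+d≡k) ⟩
  d + (h + h ∸ (h + d)) ≡⟨ cong (λ x → d + x) (NP.[m+n]∸[m+o]≡n∸o h h d) ⟩
  d + (h ∸ d)           ≡⟨ NP.m+[n∸m]≡n (NP.+-cancelˡ-≤ h d h (subst (_≤ h + h) (sym h+d≡k) k≤h+h)) ⟩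
  h                     ∎
  where
  open ≡-Reasoning
  d = k ∸ h
  h+d≡k : h + d ≡ k
  h+d≡k = NP.m+[n∸m]≡n h≤k

term′-below-lower : ∀ h k i → h ≤ k → k ≤ h + h → i < k ∸ h + e (k ∸ h) → term′ h (h + h) k i ≡ 0
term′-below-lower h k i h≤k k≤h+h i<lower =
  term′-overfull h (h + h) k i
    (subst (λ x → i + (h + h ∸ k) < x + e i) (∸-halves h≤k k≤h+h)
           (below-lower (k ∸ h) (h + h ∸ k) i i<lower))

∑<-term′≡sumRange-φ′ : ∀ h {r} k → r ≡ h + h → k ≤ r →
  ∑< (suc k) (term′ h r k) ≡ sumRange (proj₁ (φ′ h k)) (proj₂ (φ′ h k)) (term′ h r k)
∑<-term′≡sumRange-φ′ h k refl k≤h+h with k <ᵇ h in k<h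
... | true = ∑<-support _ 0 k k (λ _ ()) (term′-above h (h + h) k) (term′-above h (h + h) k)
... | false with k ≡ᵇ h in k≡h
... | true with NP.≡ᵇ⇒≡ k h (subst T (sym k≡h) _)
... | refl = ∑<-support _ 1 k k below-1 (term′-above k (k + k) k) (term′-above k (k + k) k)
  where
  below-1 : ∀ i → i < 1 → term′ k (k + k) k i ≡ 0
  below-1 zero _ = term′-overfull k (k + k) k 0
    (subst (_< k + 1) (sym (NP.m+n∸m≡n k k)) (subst (k <_) (NP.+-comm 1 k) (NP.n<1+n k)))
  below-1 (suc _) (s≤s ())
∑<-term′≡sumRange-φ′ h k refl k≤h+h | false | false =
  ∑<-support _ (k ∸ h + e (k ∸ h)) (h + e (h + 1)) k
    (λ i → term′-below-lower h k i h≤k k≤h+h) (term′-beyond-upper h (h + h) k) (term′-above h (h + h) k)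
  where
  h≤k : h ≤ k
  h≤k = NP.≮⇒≥ (λ k<h′ → subst T k<h (NP.<⇒<ᵇ k<h′))

-- The balancing number

even⇒≡half+half : ∀ {m} → 2 ∣ m → m ≡ m ℕ./ 2 + m ℕ./ 2
even⇒≡half+half {m} 2∣m = sym (trans (cong (λ x → m ℕ./ 2 + x) (sym (NP.+-identityʳ (m ℕ./ 2))))
                                     (trans (NP.*-comm 2 (m ℕ./ 2)) (m/n*n≡m 2∣m)))

*-cancel-ratio : ∀ {x y t d N} .{{_ : NonZero d}} → x * d ≡ t * N → y * d ≡ N → x ≡ t * y
*-cancel-ratio {x} {y} {t} {d} x*d≡t*N y*d≡N =
  NP.*-cancelʳ-≡ x (t * y) d (trans x*d≡t*N (trans (cong (t *_) (sym y*d≡N)) (sym (NP.*-assoc t y d))))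

/-≡-quotient : ∀ x t y .{{_ : NonZero y}} → x ≡ t * y → (+ x) / y ≡ (+ t) / 1
/-≡-quotient x t (suc y) x≡t*y = QP.fromℚᵘ-cong {QU.mkℚᵘ (+ x) y} {QU.mkℚᵘ (+ t) 0}
  (QU.*≡* (trans (ZP.*-identityʳ (+ x)) (trans (cong +_ x≡t*y) (ZP.pos-* t (suc y)))))

proposition6 : (n : ℕ) (S : List (𝔽₂^ n)) → Unique S → 2 ∣ length S → 𝟎 ∈ S →
    (r : ℕ) → HasDim ⟨ S ⟩ r → length S ≡ r + 2 →
    (s⃗ : Vec (𝔽₂^ n) r) → ((i : Fin r) → lookup s⃗ i ∈ S) → LinIndep s⃗ →
    (s : 𝔽₂^ n) → s ∈ S → s ≢ 𝟎 → ((i : Fin r) → s ≢ lookup s⃗ i) →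
    (α : Vec Bool r) → lincomb α s⃗ ≡ s →
    let k = weight α
        φ₁ = proj₁ (φ r k)
        φ₂ = proj₂ (φ r k)
    in (φ₂ < φ₁ → b S ≡ 0ℚ)
       × (φ₁ ≤ φ₂ → b S ≡ (+ sumRange φ₁ φ₂ (term r k)) / 1)
proposition6 n S _ 2∣|S| 𝟎∈S r _ length-S s⃗ s⃗⊆S s⃗-independent s s∈S s≢𝟎 s≢s⃗ α α-s =
  (λ φ₂<φ₁ → trans b≡sum (cong (λ x → (+ x) / 1) (sumRange-empty (term r k) φ₂<φ₁))) , (λ _ → b≡sum)
  where
  open Setting S 𝟎∈S length-S s⃗ s⃗⊆S s⃗-independent s s∈S s≢𝟎 s≢s⃗ α α-s
  k = weight α
  h = r ℕ./ 2
  r≡h+h : r ≡ h + h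
  r≡h+h = even⇒≡half+half (∣m+n∣m⇒∣n (subst (2 ∣_) (trans length-S (NP.+-comm r 2)) 2∣|S|) ∣-refl)
  #balanced : ℕ
  #balanced = count (balancedPattern h α) (allVec r)
  #B≡#balanced*#C : #B S ≡ #balanced * #C S
  #B≡#balanced*#C = *-cancel-ratio {#B S} {#C S} {#balanced} {{NP.m^n≢0 2 r}} (#B-S {h} r≡h+h) #C-S
  #balanced≡sum : #balanced ≡ sumRange (proj₁ (φ r k)) (proj₂ (φ r k)) (term r k)
  #balanced≡sum = trans (count-balancedPattern h α)
    (∑<-term′≡sumRange-φ′ h k r≡h+h (subst (k ≤_) (zeros+weight α) (NP.m≤n+m k (zeros α))))
  b≡sum : b S ≡ (+ sumRange (proj₁ (φ r k)) (proj₂ (φ r k)) (term r k)) / 1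
  b≡sum = trans (/-≡-quotient (#B S) #balanced (#C S) {{#C-nonZero S}} #B≡#balanced*#C)
                (cong (λ x → (+ x) / 1) #balanced≡sum)
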